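{- Let $w=a_1a_2\cdots a_n\in S_n$ be a permutation that has exactly one subsequence $a_i,a_j,a_k$ (with $i<j<k$) in the pattern $132$, i.e., with $a_i<a_k<a_j$. Then $\nu_w=\mathfrak{S}_w(1,1,\dots,1)=2$.
   Context: For $w\in S_n$, $\ell(w)$ denotes the number of inversions of $w$, and $s_i=(i,i+1)$ is the adjacent transposition. The Schubert polynomials $\mathfrak{S}_w\in\mathbb{Z}[x_1,\dots,x_{n-1}]$, $w\in S_n$, are defined by $\mathfrak{S}_{w_0}=x_1^{n-1}x_2^{n-2}\cdots x_{n-1}$ for $w_0=n,n-1,\dots,1$, and $\mathfrak{S}_{ws_i}=\partial_i\mathfrak{S}_w$ whenever $\ell(ws_i)=\ell(w)-1$, where $\partial_i f=\frac{f(\dots,x_i,x_{i+1},\dots)-f(\dots,x_{i+1},x_i,\dots)}{x_i-x_{i+1}}$. We write $\nu_w=\mathfrak{S}_w(1,1,\dots,1)$. -}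

module Defs where

open import Data.Nat using (ℕ; _<ᵇ_; zero; suc; _+_; _*_; _∸_; _<_; _<?_)
open import Data.Integer as ℤ using (ℤ; +_; -_)
open import Data.List using (List; []; _∷_; map; upTo; concatMap; length; filter; foldr)
open import Data.Maybe using (Maybe; just; nothing)
import Data.Maybe
open import Data.Bool using (if_then_else_)
open import Data.Product using (_×_; _,_)
open import Relation.Nullary using (yes; no)
open import Relation.Nullary.Decidable using (_×-dec_)
open import Data.List.Relation.Binary.Permutation.Propositional using (_↭_)

-- Permutations of S_n in one-line notation: w = a₁ a₂ ⋯ aₙ is the list
-- [a₁ , … , aₙ] of natural numbers, and w ∈ S_n means it is a
-- rearrangement of [1 , … , n].  Positions are 0-based in the code.

IsPerm : ℕ → List ℕ → Set
IsPerm n w = w ↭ map suc (upTo n)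

-- entry at (0-based) position i (default 0 out of range)
at : List ℕ → ℕ → ℕ
at []       _       = 0
at (x ∷ xs) zero    = x
at (x ∷ xs) (suc i) = at xs i

setAt : ℕ → ℕ → List ℕ → List ℕ
setAt _       _ []       = []
setAt zero    v (x ∷ xs) = v ∷ xs
setAt (suc i) v (x ∷ xs) = x ∷ setAt i v xs

triples : ℕ → List (ℕ × ℕ × ℕ)
triples n = concatMap (λ i → concatMap (λ j → map (λ k → i , j , k) (upTo n)) (upTo n)) (upTo n)

count132 : List ℕ → ℕ
count132 w = length (filter
  (λ { (i , j , k) → (i <? j) ×-dec ((j <? k) ×-dec ((at w i <? at w k) ×-dec (at w k <? at w j))) })
  (triples (length w)))

-- Polynomials in ℤ[x₁,…,xₙ] as (unnormalised) formal sums of terms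
-- c · x^e, where e is the exponent list (e at position i = exponent of x_{i+1}).

Poly : Set
Poly = List (ℤ × List ℕ)

-- Divided difference ∂ (0-based index i, i.e. acting on x_{i+1}, x_{i+2}),
-- computed termwise: for the monomial x^p y^q (x = x_{i+1}, y = x_{i+2}),
--   (x^p y^q - x^q y^p)/(x - y) = Σ_{t<p-q} x^{p-1-t} y^{q+t}     if p > q,
--                                = - Σ_{t<q-p} x^{q-1-t} y^{p+t}  if p < q,
--                                = 0                               if p = q.
∂term : ℕ → ℤ × List ℕ → Poly
∂term i (c , e) with at e (suc i) <? at e i | at e i <? at e (suc i)
... | yes _ | _ = map (λ t → c , setAt (suc i) (q + t) (setAt i (p ∸ suc t) e)) (upTo (p ∸ q))
  where p = at e i ; q = at e (suc i)
... | no _ | yes _ = map (λ t → - c , setAt (suc i) (p + t) (setAt i (q ∸ suc t) e)) (upTo (q ∸ p))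
  where p = at e i ; q = at e (suc i)
... | no _ | no _ = []

∂ : ℕ → Poly → Poly
∂ i f = concatMap (∂term i) f

-- S_{w₀} = x₁^{n-1} x₂^{n-2} ⋯ x_{n-1}; and if w(i) < w(i+1) (so that
-- ℓ(w s_i) = ℓ(w)+1) then S_w = ∂_i S_{w s_i}.  We always use the first
-- ascent of w; w s_i is w with the entries at positions i, i+1 swapped.
-- Recursion is on a fuel parameter; fuel n*n ≥ C(n,2) ≥ ℓ(w₀) - ℓ(w)
-- is always enough, so the fuel-exhausted branch is never reached.

firstAscent : List ℕ → Maybe ℕ
firstAscent []       = nothing
firstAscent (x ∷ xs) = go x xs
  where
  go : ℕ → List ℕ → Maybe ℕ
  go x []       = nothing
  go x (y ∷ ys) = if x <ᵇ y then just 0 else Data.Maybe.map suc (go y ys)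

swapAt : ℕ → List ℕ → List ℕ
swapAt i w = setAt (suc i) (at w i) (setAt i (at w (suc i)) w)

topMonomial : ℕ → List ℕ
topMonomial n = map (λ k → n ∸ suc k) (upTo n)

schubFuel : ℕ → ℕ → List ℕ → Poly
schubFuel fuel n w with firstAscent w
... | nothing = (+ 1 , topMonomial n) ∷ []
schubFuel zero       n w | just i = []
schubFuel (suc fuel) n w | just i = ∂ i (schubFuel fuel n (swapAt i w))

schubert : List ℕ → Poly
schubert w = schubFuel (length w * length w) (length w) w

evalOnes : Poly → ℤ
evalOnes f = foldr (λ { (c , _) acc → c ℤ.+ acc }) (+ 0) f

ν : List ℕ → ℤ
ν w = evalOnes (schubert w)

-- Compute 𝔖_w along first ascents: if the first ascent of w is a < b at position i, then 𝔖_w = ∂_i 𝔖_w′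
-- with w′ = w s_i, and track exponents through Lehmer codes. Since every entry before a exceeds a, the swap
-- removes exactly k occurrences of 132, k being the number of later entries between a and b, and it turns the
-- code entries (c, k + c) of a, b into (1 + k + c, c). If w avoids 132, then k = 0 throughout and ∂_i sends
-- x^code(w′) to x^code(w), so 𝔖_w = x^code(w). If w contains one 132, either k = 1 and w′ avoids 132, so ∂_i
-- splits x^code(w′) into two monomials, or k = 0 and the unique 132 of w′ lies to the right of the ascent, so
-- ∂_i merely shifts both monomials of 𝔖_w′. Thus 𝔖_w is a sum of two monomials with coefficient 1: ν_w = 2.

module Submission where

open import Defs
open import Data.Nat using (ℕ)
open import Data.Integer using (+_)
open import Data.List using (List)
open import Relation.Binary.PropositionalEquality using (_≡_)

open import Data.Bool using (Bool; true; false; _∧_; T)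
open import Data.Empty using (⊥; ⊥-elim)
open import Data.List using ([]; _∷_; _++_; length; filter; map; concatMap; applyUpTo; upTo)
open import Data.List.Properties using (++-assoc; ++-identityʳ; ∷-injective; map-applyUpTo)
open import Data.List.Membership.Propositional using (_∈_)
open import Data.List.Relation.Binary.Permutation.Propositional using (_↭_; ↭-refl; ↭-sym; ↭-swap; ↭⇒↭ₛ)
open import Data.List.Relation.Binary.Permutation.Propositional.Properties using (++⁺ˡ; ↭-length)
import Data.List.Relation.Binary.Permutation.Setoid.Properties as Perm
open import Data.List.Relation.Unary.All using (All; []; _∷_; lookup; zipWith)
import Data.List.Relation.Unary.All as All
import Data.List.Relation.Unary.All.Properties as AllProp
open import Data.List.Relation.Unary.AllPairs using ([]; _∷_)
open import Data.List.Relation.Unary.Any using (here; there)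
open import Data.List.Relation.Unary.Linked using (Linked; []; [-]; _∷_)
import Data.List.Relation.Unary.Linked as Linked
open import Data.List.Relation.Unary.Linked.Properties using (Linked⇒All)
open import Data.List.Relation.Unary.Unique.Propositional using (Unique)
import Data.List.Relation.Unary.Unique.Propositional.Properties as Unique
open import Data.Maybe using (Maybe; just; nothing)
import Data.Maybe as Maybe
open import Data.Nat using (zero; suc; _+_; _*_; _∸_; _<ᵇ_; _<_; _≤_; _≥_; _<?_; z≤n; s≤s)
open import Data.Nat.Properties
open import Algebra.Properties.CommutativeSemigroup +-commutativeSemigroup using (interchange; x∙yz≈y∙xz)
open import Data.Product using (Σ-syntax; _×_; _,_; proj₁; proj₂)
open import Data.Sum using (_⊎_; inj₁; inj₂)
open import Data.Unit using (tt)
open import Function using (_∘_; id)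
open import Level using (0ℓ)
open import Relation.Binary using (tri<; tri≈; tri>)
open import Relation.Binary.PropositionalEquality
  using (_≢_; refl; sym; trans; cong; cong₂; subst; subst₂; setoid; module ≡-Reasoning)
open import Relation.Nullary using (¬_; yes; no; does)
open import Relation.Unary using (Pred; Decidable)

bit : Bool → ℕ
bit true  = 1
bit false = 0

<ᵇ-true : ∀ {m n} → m < n → (m <ᵇ n) ≡ true
<ᵇ-true {m} {n} m<n with m <ᵇ n | <⇒<ᵇ m<n
... | true | _ = refl

<ᵇ-false : ∀ {m n} → ¬ m < n → (m <ᵇ n) ≡ false
<ᵇ-false {m} {n} m≮n with m <ᵇ n | <ᵇ⇒< m n
... | true  | m<n = ⊥-elim (m≮n (m<n tt))
... | false | _   = refl

<ᵇ-true⁻¹ : ∀ {m n} → (m <ᵇ n) ≡ true → m < n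
<ᵇ-true⁻¹ {m} {n} eq = <ᵇ⇒< m n (subst T (sym eq) tt)

<ᵇ-false⁻¹ : ∀ {m n} → (m <ᵇ n) ≡ false → n ≤ m
<ᵇ-false⁻¹ eq = ≮⇒≥ (λ m<n → subst T eq (<⇒<ᵇ m<n))

countᵇ : (ℕ → Bool) → List ℕ → ℕ
countᵇ p []       = 0
countᵇ p (x ∷ xs) = bit (p x) + countᵇ p xs

below : ℕ → ℕ → Bool
below x z = z <ᵇ x

between : ℕ → ℕ → ℕ → Bool
between a b z = (a <ᵇ z) ∧ (z <ᵇ b)

between-true⁻¹ : ∀ {a b z} → between a b z ≡ true → a < z × z < b
between-true⁻¹ {a} {b} {z} eq with a <ᵇ z in a<z | z <ᵇ b in z<b
between-true⁻¹ refl | true | true = <ᵇ-true⁻¹ a<z , <ᵇ-true⁻¹ z<b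

between-true : ∀ {a b z} → a < z → z < b → between a b z ≡ true
between-true a<z z<b rewrite <ᵇ-true a<z | <ᵇ-true z<b = refl

between-false : ∀ {a b z} → (a < z → z < b → ⊥) → between a b z ≡ false
between-false {a} {b} {z} ¬btw with a <ᵇ z in a<z | z <ᵇ b in z<b
... | true  | true  = ⊥-elim (¬btw (<ᵇ-true⁻¹ a<z) (<ᵇ-true⁻¹ z<b))
... | true  | false = refl
... | false | _     = refl

between-empty : ∀ {a x} → a ≤ x → ∀ z → between x a z ≡ false
between-empty a≤x z = between-false (λ x<z z<a → <⇒≱ (<-trans x<z z<a) a≤x)

countᵇ-swap : ∀ p X a b Y → countᵇ p (X ++ a ∷ b ∷ Y) ≡ countᵇ p (X ++ b ∷ a ∷ Y)
countᵇ-swap p []      a b Y = x∙yz≈y∙xz (bit (p a)) (bit (p b)) (countᵇ p Y)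
countᵇ-swap p (x ∷ X) a b Y = cong (_+_ (bit (p x))) (countᵇ-swap p X a b Y)

countᵇ-none : ∀ p xs → (∀ z → p z ≡ false) → countᵇ p xs ≡ 0
countᵇ-none p []       _    = refl
countᵇ-none p (x ∷ xs) none rewrite none x = countᵇ-none p xs none

countᵇ-all : ∀ p xs → All (λ z → p z ≡ true) xs → countᵇ p xs ≡ length xs
countᵇ-all p []       []          = refl
countᵇ-all p (x ∷ xs) (px ∷ pxs) rewrite px = cong suc (countᵇ-all p xs pxs)

countᵇ-pos : ∀ p {xs z} → z ∈ xs → p z ≡ true → 1 ≤ countᵇ p xs
countᵇ-pos p {x ∷ xs} (here refl) pz rewrite pz = s≤s z≤n
countᵇ-pos p {x ∷ xs} (there z∈xs) pz = ≤-trans (countᵇ-pos p z∈xs pz) (m≤n+m _ (bit (p x)))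

countᵇ-witness : ∀ p xs {k} → countᵇ p xs ≡ suc k → Σ[ z ∈ ℕ ] z ∈ xs × p z ≡ true
countᵇ-witness p (x ∷ xs) eq with p x in px
... | true  = x , here refl , px
... | false with countᵇ-witness p xs eq
...   | z , z∈xs , pz = z , there z∈xs , pz

countᵇ≤length : ∀ p xs → countᵇ p xs ≤ length xs
countᵇ≤length p []       = z≤n
countᵇ≤length p (x ∷ xs) with p x
... | true  = s≤s (countᵇ≤length p xs)
... | false = m≤n⇒m≤1+n (countᵇ≤length p xs)

countᵇ-below-skip : ∀ {a b} xs → a < b → countᵇ (below a) (b ∷ xs) ≡ countᵇ (below a) xs
countᵇ-below-skip _ a<b rewrite <ᵇ-false (<⇒≯ a<b) = refl

countᵇ-below-hit : ∀ {a b} xs → a < b → countᵇ (below b) (a ∷ xs) ≡ suc (countᵇ (below b) xs)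
countᵇ-below-hit _ a<b rewrite <ᵇ-true a<b = refl

bit-below-split : ∀ {a b} z → a < b → a ≢ z → bit (below b z) ≡ bit (between a b z) + bit (below a z)
bit-below-split {a} z a<b a≢z with <-cmp z a
... | tri< z<a _ _ rewrite <ᵇ-true (<-trans z<a a<b) | <ᵇ-true z<a | <ᵇ-false (<⇒≯ z<a) = refl
... | tri≈ _ z≡a _ = ⊥-elim (a≢z (sym z≡a))
... | tri> _ _ a<z rewrite <ᵇ-false (<⇒≯ a<z) | <ᵇ-true a<z = sym (+-identityʳ _)

countᵇ-below-split : ∀ {a b} xs → a < b → All (a ≢_) xs →
  countᵇ (below b) xs ≡ countᵇ (between a b) xs + countᵇ (below a) xs
countᵇ-below-split []       a<b []           = refl
countᵇ-below-split {a} {b} (x ∷ xs) a<b (a≢x ∷ a∉xs)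
  rewrite bit-below-split x a<b a≢x | countᵇ-below-split xs a<b a∉xs =
    interchange (bit (between a b x)) (bit (below a x)) (countᵇ (between a b) xs) (countᵇ (below a) xs)

-- Occurrences of 132, counted recursively

count132From : ℕ → List ℕ → ℕ
count132From x []       = 0
count132From x (y ∷ ys) = countᵇ (between x y) ys + count132From x ys

count132ʳ : List ℕ → ℕ
count132ʳ []       = 0
count132ʳ (x ∷ xs) = count132From x xs + count132ʳ xs

sumBelow : ℕ → (ℕ → ℕ) → ℕ
sumBelow zero    f = 0
sumBelow (suc n) f = f 0 + sumBelow n (f ∘ suc)

sumBelow-cong : ∀ n {f g : ℕ → ℕ} → (∀ i → f i ≡ g i) → sumBelow n f ≡ sumBelow n g
sumBelow-cong zero    f≗g = refl
sumBelow-cong (suc n) f≗g = cong₂ _+_ (f≗g 0) (sumBelow-cong n (f≗g ∘ suc))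

sumBelow-zero : ∀ n {f : ℕ → ℕ} → (∀ i → f i ≡ 0) → sumBelow n f ≡ 0
sumBelow-zero zero    f≗0 = refl
sumBelow-zero (suc n) f≗0 rewrite f≗0 0 = sumBelow-zero n (f≗0 ∘ suc)

sumBelow-countᵇ : ∀ p ys → sumBelow (length ys) (λ k → bit (p (at ys k))) ≡ countᵇ p ys
sumBelow-countᵇ p []       = refl
sumBelow-countᵇ p (y ∷ ys) = cong (_+_ (bit (p y))) (sumBelow-countᵇ p ys)

module _ {A : Set} {P : Pred A 0ℓ} (P? : Decidable P) where

  private
    count : List A → ℕ
    count xs = length (filter P? xs)

  count-∷ : ∀ x xs → count (x ∷ xs) ≡ bit (does (P? x)) + count xs
  count-∷ x xs with does (P? x)
  ... | true  = refl
  ... | false = refl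

  count-++ : ∀ xs ys → count (xs ++ ys) ≡ count xs + count ys
  count-++ []       ys = refl
  count-++ (x ∷ xs) ys rewrite count-∷ x (xs ++ ys) | count-∷ x xs | count-++ xs ys =
    sym (+-assoc (bit (does (P? x))) _ _)

  count-concatMap : ∀ {B : Set} (F : B → List A) (g : ℕ → B) n →
    count (concatMap F (applyUpTo g n)) ≡ sumBelow n (λ i → count (F (g i)))
  count-concatMap F g zero    = refl
  count-concatMap F g (suc n) rewrite count-++ (F (g 0)) (concatMap F (applyUpTo (g ∘ suc) n)) =
    cong (_+_ (count (F (g 0)))) (count-concatMap F (g ∘ suc) n)

  count-map : ∀ {B : Set} (h : B → A) (g : ℕ → B) n →
    count (map h (applyUpTo g n)) ≡ sumBelow n (λ i → bit (does (P? (h (g i)))))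
  count-map h g zero    = refl
  count-map h g (suc n) rewrite count-∷ (h (g 0)) (map h (applyUpTo (g ∘ suc) n)) =
    cong (_+_ (bit (does (P? (h (g 0)))))) (count-map h (g ∘ suc) n)

occurs132 : List ℕ → ℕ → ℕ → ℕ → ℕ
occurs132 w i j k = bit ((i <ᵇ j) ∧ ((j <ᵇ k) ∧ ((at w i <ᵇ at w k) ∧ (at w k <ᵇ at w j))))

count132Σ : List ℕ → ℕ → ℕ
count132Σ w n = sumBelow n λ i → sumBelow n λ j → sumBelow n λ k → occurs132 w i j k

count132≡count132Σ : ∀ w → count132 w ≡ count132Σ w (length w)
count132≡count132Σ w = trans (count-concatMap _ _ id n) (sumBelow-cong n λ i →
  trans (count-concatMap _ _ id n) (sumBelow-cong n λ j → count-map _ _ id n))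
  where n = length w

count132FromΣ : ℕ → List ℕ → ℕ → ℕ
count132FromΣ x ys m = sumBelow m λ j → sumBelow m λ k →
  bit ((j <ᵇ k) ∧ ((x <ᵇ at ys k) ∧ (at ys k <ᵇ at ys j)))

count132FromΣ≡count132From : ∀ x ys → count132FromΣ x ys (length ys) ≡ count132From x ys
count132FromΣ≡count132From x []       = refl
count132FromΣ≡count132From x (y ∷ ys) =
  cong₂ _+_ (sumBelow-countᵇ (between x y) ys) (count132FromΣ≡count132From x ys)

bit-∧-false : ∀ b → bit (b ∧ false) ≡ 0
bit-∧-false true  = refl
bit-∧-false false = refl

-- Only triples starting at position 0 involve the head; the remaining ones are those of the tail.
count132Σ-∷ : ∀ x xs → count132Σ (x ∷ xs) (suc (length xs)) ≡ count132From x xs + count132Σ xs (length xs)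
count132Σ-∷ x xs = cong₂ _+_
  (trans (cong (_+ count132FromΣ x xs m) (sumBelow-zero (suc m) (λ _ → refl)))
         (count132FromΣ≡count132From x xs))
  (sumBelow-cong m λ i → cong₂ _+_
    (sumBelow-zero (suc m) {λ k → occurs132 (x ∷ xs) (suc i) 0 k} (λ _ → refl))
    (sumBelow-cong m λ j → cong (_+ sumBelow m (occurs132 xs i j)) (bit-∧-false (i <ᵇ j))))
  where m = length xs

count132Σ≡count132ʳ : ∀ w → count132Σ w (length w) ≡ count132ʳ w
count132Σ≡count132ʳ []       = refl
count132Σ≡count132ʳ (x ∷ xs) =
  trans (count132Σ-∷ x xs) (cong (_+_ (count132From x xs)) (count132Σ≡count132ʳ xs))

count132≡count132ʳ : ∀ w → count132 w ≡ count132ʳ w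
count132≡count132ʳ w = trans (count132≡count132Σ w) (count132Σ≡count132ʳ w)

adjacentSwap↭ : ∀ pre (a b : ℕ) post → pre ++ a ∷ b ∷ post ↭ pre ++ b ∷ a ∷ post
adjacentSwap↭ pre a b post = ++⁺ˡ pre (↭-swap a b ↭-refl)

IsPerm⇒Unique : ∀ n w → IsPerm n w → Unique w
IsPerm⇒Unique n w w↭ =
  Perm.Unique-resp-↭ (setoid ℕ) (↭⇒↭ₛ (↭-sym w↭)) (Unique.map⁺ suc-injective (Unique.upTo⁺ n))

Unique-swap : ∀ pre {a b : ℕ} post → Unique (pre ++ a ∷ b ∷ post) → Unique (pre ++ b ∷ a ∷ post)
Unique-swap pre post = Perm.Unique-resp-↭ (setoid ℕ) (↭⇒↭ₛ (adjacentSwap↭ pre _ _ post))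

Unique⇒∉suffix : ∀ pre {a : ℕ} rest → Unique (pre ++ a ∷ rest) → All (a ≢_) rest
Unique⇒∉suffix []        rest (a∉rest ∷ _) = a∉rest
Unique⇒∉suffix (_ ∷ pre) rest (_ ∷ u)      = Unique⇒∉suffix pre rest u

count132From-swap : ∀ {x a} X b Y → a ≤ x →
  count132From x (X ++ a ∷ b ∷ Y) ≡ count132From x (X ++ b ∷ a ∷ Y)
count132From-swap {x} {a} [] b Y a≤x
  rewrite countᵇ-none (between x a) (b ∷ Y) (between-empty a≤x)
        | countᵇ-none (between x a) Y (between-empty a≤x)
        | between-false {x} {b} {a} (λ x<a _ → <⇒≱ x<a a≤x) = refl
count132From-swap {x} (y ∷ X) b Y a≤x =
  cong₂ _+_ (countᵇ-swap (between x y) X _ b Y) (count132From-swap X b Y a≤x)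

count132ʳ-swap : ∀ pre {a b} post → a < b → All (a ≤_) pre →
  count132ʳ (pre ++ a ∷ b ∷ post) ≡ countᵇ (between a b) post + count132ʳ (pre ++ b ∷ a ∷ post)
count132ʳ-swap [] {a} {b} post a<b [] rewrite countᵇ-none (between b a) post (between-empty (<⇒≤ a<b)) = begin
  (k + p) + (q + n) ≡⟨ +-assoc k p (q + n) ⟩
  k + (p + (q + n)) ≡⟨ cong (_+_ k) (x∙yz≈y∙xz p q n) ⟩
  k + (q + (p + n)) ∎
  where
  open ≡-Reasoning
  k = countᵇ (between a b) post
  p = count132From a post
  q = count132From b post
  n = count132ʳ post
count132ʳ-swap (x ∷ pre) {a} {b} post a<b (a≤x ∷ a≤pre)
  rewrite count132From-swap pre b post a≤x | count132ʳ-swap pre post a<b a≤pre =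
  x∙yz≈y∙xz (count132From x (pre ++ b ∷ a ∷ post)) (countᵇ (between a b) post) (count132ʳ (pre ++ b ∷ a ∷ post))

count132ʳ-++-≥ : ∀ P X → count132ʳ X ≤ count132ʳ (P ++ X)
count132ʳ-++-≥ []      X = ≤-refl
count132ʳ-++-≥ (x ∷ P) X = ≤-trans (count132ʳ-++-≥ P X) (m≤n+m _ _)

-- For a permutation this counts the pairs i < j with a_i < a_j, i.e. ℓ(w₀) - ℓ(w).
nonInversions : List ℕ → ℕ
nonInversions []       = 0
nonInversions (x ∷ xs) = (length xs ∸ countᵇ (below x) xs) + nonInversions xs

nonInversions-swap : ∀ pre {a b} post → a < b →
  nonInversions (pre ++ a ∷ b ∷ post) ≡ suc (nonInversions (pre ++ b ∷ a ∷ post))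
nonInversions-swap [] {a} {b} post a<b
  rewrite countᵇ-below-skip post a<b | countᵇ-below-hit post a<b
        | +-∸-assoc 1 (countᵇ≤length (below a) post) =
  cong suc (x∙yz≈y∙xz (length post ∸ countᵇ (below a) post) (length post ∸ countᵇ (below b) post)
                      (nonInversions post))
nonInversions-swap (x ∷ pre) {a} {b} post a<b
  rewrite ↭-length (adjacentSwap↭ pre a b post) | countᵇ-swap (below x) pre a b post
        | nonInversions-swap pre post a<b = +-suc _ _

nonInversions≤length² : ∀ xs → nonInversions xs ≤ length xs * length xs
nonInversions≤length² []       = z≤n
nonInversions≤length² (x ∷ xs) =
  +-mono-≤ (≤-trans (m∸n≤m L (countᵇ (below x) xs)) (n≤1+n L))
           (≤-trans (nonInversions≤length² xs) (*-monoʳ-≤ L (n≤1+n L)))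
  where L = length xs

NoAscent : List ℕ → Set
NoAscent = Linked _≥_

NoAscent⇒All≤head : ∀ {x xs} → NoAscent (x ∷ xs) → All (_≤ x) xs
NoAscent⇒All≤head [-]      = []
NoAscent⇒All≤head (y≤x ∷ l) = Linked⇒All (λ z≤y y≤x → ≤-trans y≤x z≤y) y≤x l

NoAscent⇒All≥last : ∀ pre {a} → NoAscent (pre ++ a ∷ []) → All (a ≤_) pre
NoAscent⇒All≥last []        l = []
NoAscent⇒All≥last (x ∷ pre) l =
  lookup (AllProp.++⁻ʳ pre (NoAscent⇒All≤head l)) (here refl) ∷ NoAscent⇒All≥last pre (Linked.tail l)

NoAscent-adjacent : ∀ X {x y Y} → NoAscent (X ++ x ∷ y ∷ Y) → y ≤ x
NoAscent-adjacent []      (y≤x ∷ _) = y≤x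
NoAscent-adjacent (_ ∷ X) l         = NoAscent-adjacent X (Linked.tail l)

count132From-all≤ : ∀ x xs → All (_≤ x) xs → count132From x xs ≡ 0
count132From-all≤ x []       []           = refl
count132From-all≤ x (y ∷ ys) (y≤x ∷ ys≤x) rewrite count132From-all≤ x ys ys≤x =
  trans (+-identityʳ _) (countᵇ-none (between x y) ys (between-empty y≤x))

count132ʳ-noAscent : ∀ w → NoAscent w → count132ʳ w ≡ 0
count132ʳ-noAscent []       _ = refl
count132ʳ-noAscent (x ∷ xs) l rewrite count132From-all≤ x xs (NoAscent⇒All≤head l) =
  count132ʳ-noAscent xs (Linked.tail l)

record AscentAt (w : List ℕ) (i : ℕ) : Set where
  constructor ascentAt
  field
    pre        : List ℕ
    a b        : ℕ
    post       : List ℕ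
    w≡         : w ≡ pre ++ a ∷ b ∷ post
    i≡         : length pre ≡ i
    a<b        : a < b
    noAscent   : NoAscent (pre ++ a ∷ [])

map-suc-just : ∀ (m : Maybe ℕ) {i} → Maybe.map suc m ≡ just i → Σ[ j ∈ ℕ ] m ≡ just j × i ≡ suc j
map-suc-just (just j) refl = j , refl , refl

NoAscent-cons : ∀ {x y ys a zs} pre → y ≤ x → y ∷ ys ≡ pre ++ a ∷ zs →
  NoAscent (pre ++ a ∷ []) → NoAscent (x ∷ pre ++ a ∷ [])
NoAscent-cons []      y≤x refl l = y≤x ∷ l
NoAscent-cons (_ ∷ _) y≤x refl l = y≤x ∷ l

firstAscent-just : ∀ w i → firstAscent w ≡ just i → AscentAt w i
firstAscent-just (x ∷ y ∷ ys) i eq with x <ᵇ y in x<y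
firstAscent-just (x ∷ y ∷ ys) _ refl | true = ascentAt [] x y ys refl refl (<ᵇ-true⁻¹ x<y) [-]
... | false with map-suc-just (firstAscent (y ∷ ys)) eq
... | j , eq′ , refl with firstAscent-just (y ∷ ys) j eq′
... | ascentAt pre a b post w≡ refl a<b l =
  ascentAt (x ∷ pre) a b post (cong (x ∷_) w≡) refl a<b (NoAscent-cons pre (<ᵇ-false⁻¹ x<y) w≡ l)

map-suc-nothing : ∀ (m : Maybe ℕ) → Maybe.map suc m ≡ nothing → m ≡ nothing
map-suc-nothing nothing _ = refl

firstAscent-nothing-∷ : ∀ x y ys → firstAscent (x ∷ y ∷ ys) ≡ nothing → y ≤ x × firstAscent (y ∷ ys) ≡ nothing
firstAscent-nothing-∷ x y ys eq with x <ᵇ y in x<y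
... | false = <ᵇ-false⁻¹ x<y , map-suc-nothing (firstAscent (y ∷ ys)) eq

firstAscent-nothing : ∀ w → firstAscent w ≡ nothing → NoAscent w
firstAscent-nothing []           _  = []
firstAscent-nothing (x ∷ [])     _  = [-]
firstAscent-nothing (x ∷ y ∷ ys) eq =
  proj₁ (firstAscent-nothing-∷ x y ys eq) ∷
  firstAscent-nothing (y ∷ ys) (proj₂ (firstAscent-nothing-∷ x y ys eq))

-- Lehmer codes

lehmerCode : List ℕ → List ℕ
lehmerCode []       = []
lehmerCode (x ∷ xs) = countᵇ (below x) xs ∷ lehmerCode xs

prefixCode : List ℕ → List ℕ → List ℕ
prefixCode []      R = []
prefixCode (x ∷ P) R = countᵇ (below x) (P ++ R) ∷ prefixCode P R

lehmerCode-++ : ∀ P R → lehmerCode (P ++ R) ≡ prefixCode P R ++ lehmerCode R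
lehmerCode-++ []      R = refl
lehmerCode-++ (x ∷ P) R = cong (countᵇ (below x) (P ++ R) ∷_) (lehmerCode-++ P R)

lehmerCode-split : ∀ pre (a b : ℕ) post →
  lehmerCode (pre ++ a ∷ b ∷ post) ≡ prefixCode (pre ++ a ∷ b ∷ []) post ++ lehmerCode post
lehmerCode-split pre a b post =
  subst (λ w → lehmerCode w ≡ prefixCode (pre ++ a ∷ b ∷ []) post ++ lehmerCode post)
        (++-assoc pre (a ∷ b ∷ []) post) (lehmerCode-++ (pre ++ a ∷ b ∷ []) post)

prefixCode-++ : ∀ P₁ P₂ R → prefixCode (P₁ ++ P₂) R ≡ prefixCode P₁ (P₂ ++ R) ++ prefixCode P₂ R
prefixCode-++ []       P₂ R = refl
prefixCode-++ (x ∷ P₁) P₂ R rewrite ++-assoc P₁ P₂ R =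
  cong (countᵇ (below x) (P₁ ++ P₂ ++ R) ∷_) (prefixCode-++ P₁ P₂ R)

prefixCode-swap : ∀ P (a b : ℕ) Y → prefixCode P (a ∷ b ∷ Y) ≡ prefixCode P (b ∷ a ∷ Y)
prefixCode-swap []      a b Y = refl
prefixCode-swap (x ∷ P) a b Y = cong₂ _∷_ (countᵇ-swap (below x) P a b Y) (prefixCode-swap P a b Y)

length-prefixCode : ∀ P R → length (prefixCode P R) ≡ length P
length-prefixCode []      R = refl
length-prefixCode (x ∷ P) R = cong suc (length-prefixCode P R)

prefixCode-ascent : ∀ pre {a b} R Y M {k} → a < b → All (a ≢_) (R ++ Y) → countᵇ (between a b) (R ++ Y) ≡ k →
  prefixCode (pre ++ a ∷ b ∷ R) Y ++ M ≡
  prefixCode pre (a ∷ b ∷ R ++ Y) ++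
    countᵇ (below a) (R ++ Y) ∷ k + countᵇ (below a) (R ++ Y) ∷ prefixCode R Y ++ M
prefixCode-ascent pre {a} {b} R Y M a<b a∉ refl
  rewrite prefixCode-++ pre (a ∷ b ∷ R) Y | countᵇ-below-skip (R ++ Y) a<b
        | countᵇ-below-split (R ++ Y) a<b a∉ =
  ++-assoc (prefixCode pre (a ∷ b ∷ R ++ Y)) _ M

prefixCode-descent : ∀ pre {a b} R Y M {k} → a < b → All (a ≢_) (R ++ Y) → countᵇ (between a b) (R ++ Y) ≡ k →
  prefixCode (pre ++ b ∷ a ∷ R) Y ++ M ≡
  prefixCode pre (a ∷ b ∷ R ++ Y) ++
    suc (k + countᵇ (below a) (R ++ Y)) ∷ countᵇ (below a) (R ++ Y) ∷ prefixCode R Y ++ M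
prefixCode-descent pre {a} {b} R Y M a<b a∉ refl
  rewrite prefixCode-++ pre (b ∷ a ∷ R) Y | countᵇ-below-hit (R ++ Y) a<b | countᵇ-below-split (R ++ Y) a<b a∉
        | prefixCode-swap pre a b (R ++ Y) =
  ++-assoc (prefixCode pre (b ∷ a ∷ R ++ Y)) _ M

staircase : ℕ → List ℕ
staircase n = applyUpTo (λ k → n ∸ suc k) n

topMonomial≡staircase : ∀ n → topMonomial n ≡ staircase n
topMonomial≡staircase n = map-applyUpTo id (λ k → n ∸ suc k) n

lehmerCode-noAscent : ∀ w → NoAscent w → Unique w → lehmerCode w ≡ staircase (length w)
lehmerCode-noAscent []       _ _           = refl
lehmerCode-noAscent (x ∷ xs) l (x∉xs ∷ u) =
  cong₂ _∷_ (countᵇ-all (below x) xs (zipWith below-x (NoAscent⇒All≤head l , x∉xs)))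
            (lehmerCode-noAscent xs (Linked.tail l) u)
  where
  below-x : ∀ {z} → z ≤ x × x ≢ z → below x z ≡ true
  below-x (z≤x , x≢z) = <ᵇ-true (≤∧≢⇒< z≤x (x≢z ∘ sym))

-- Divided differences of the relevant monomials

at-length : ∀ E (x : ℕ) xs → at (E ++ x ∷ xs) (length E) ≡ x
at-length []      x xs = refl
at-length (_ ∷ E) x xs = at-length E x xs

at-suc-length : ∀ E (x y : ℕ) xs → at (E ++ x ∷ y ∷ xs) (suc (length E)) ≡ y
at-suc-length []      x y xs = refl
at-suc-length (_ ∷ E) x y xs = at-suc-length E x y xs

setAt-length : ∀ E (x v : ℕ) xs → setAt (length E) v (E ++ x ∷ xs) ≡ E ++ v ∷ xs
setAt-length []      x v xs = refl
setAt-length (e ∷ E) x v xs = cong (e ∷_) (setAt-length E x v xs)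

setAt-suc-length : ∀ E (x y v : ℕ) xs → setAt (suc (length E)) v (E ++ x ∷ y ∷ xs) ≡ E ++ x ∷ v ∷ xs
setAt-suc-length []      x y v xs = refl
setAt-suc-length (e ∷ E) x y v xs = cong (e ∷_) (setAt-suc-length E x y v xs)

swapAt-length : ∀ E (a b : ℕ) xs → swapAt (length E) (E ++ a ∷ b ∷ xs) ≡ E ++ b ∷ a ∷ xs
swapAt-length E a b xs
  rewrite at-length E a (b ∷ xs) | at-suc-length E a b xs | setAt-length E a b (b ∷ xs)
        | setAt-suc-length E b b a xs = refl

∂term-descent : ∀ i z e → at e (suc i) < at e i →
  ∂term i (z , e) ≡
  map (λ t → z , setAt (suc i) (at e (suc i) + t) (setAt i (at e i ∸ suc t) e)) (upTo (at e i ∸ at e (suc i)))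
∂term-descent i z e q<p with at e (suc i) <? at e i
... | yes _   = refl
... | no  q≮p = ⊥-elim (q≮p q<p)

∂term-lower : ∀ {i} E q r z → length E ≡ i → ∂term i (z , E ++ suc q ∷ q ∷ r) ≡ (z , E ++ q ∷ q ∷ r) ∷ []
∂term-lower E q r z refl
  rewrite ∂term-descent (length E) z (E ++ suc q ∷ q ∷ r)
            (subst₂ _<_ (sym (at-suc-length E (suc q) q r)) (sym (at-length E (suc q) (q ∷ r))) (n<1+n q))
        | at-length E (suc q) (q ∷ r) | at-suc-length E (suc q) q r | m+n∸n≡m 1 q | +-identityʳ q
        | setAt-length E (suc q) q (q ∷ r) | setAt-suc-length E q q q r = refl

∂term-split : ∀ {i} E q r z → length E ≡ i →
  ∂term i (z , E ++ suc (suc q) ∷ q ∷ r) ≡ (z , E ++ suc q ∷ q ∷ r) ∷ (z , E ++ q ∷ suc q ∷ r) ∷ []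
∂term-split E q r z refl
  rewrite ∂term-descent (length E) z (E ++ suc (suc q) ∷ q ∷ r)
            (subst₂ _<_ (sym (at-suc-length E (suc (suc q)) q r)) (sym (at-length E (suc (suc q)) (q ∷ r)))
              (m<n⇒m<1+n (n<1+n q)))
        | at-length E (suc (suc q)) (q ∷ r) | at-suc-length E (suc (suc q)) q r | m+n∸n≡m 2 q
        | +-identityʳ q | +-comm q 1
        | setAt-length E (suc (suc q)) q (q ∷ r) | setAt-suc-length E q q (suc q) r
        | setAt-length E (suc (suc q)) (suc q) (q ∷ r) | setAt-suc-length E (suc q) q q r = refl

∂-singleton : ∀ i t → ∂ i (t ∷ []) ≡ ∂term i t
∂-singleton i t = ++-identityʳ (∂term i t)

∂term-prefixCode-unswap : ∀ pre {a b} R Y M z → a < b → All (a ≢_) (R ++ Y) →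
  countᵇ (between a b) (R ++ Y) ≡ 0 →
  ∂term (length pre) (z , prefixCode (pre ++ b ∷ a ∷ R) Y ++ M) ≡
  (z , prefixCode (pre ++ a ∷ b ∷ R) Y ++ M) ∷ []
∂term-prefixCode-unswap pre {a} {b} R Y M z a<b a∉ k≡0 = begin
  ∂term (length pre) (z , prefixCode (pre ++ b ∷ a ∷ R) Y ++ M)
    ≡⟨ cong (λ e → ∂term (length pre) (z , e)) (prefixCode-descent pre R Y M a<b a∉ k≡0) ⟩
  ∂term (length pre) (z , E ++ suc c ∷ c ∷ prefixCode R Y ++ M)
    ≡⟨ ∂term-lower E c (prefixCode R Y ++ M) z (length-prefixCode pre _) ⟩
  (z , E ++ c ∷ c ∷ prefixCode R Y ++ M) ∷ []
    ≡⟨ cong (λ e → (z , e) ∷ []) (sym (prefixCode-ascent pre R Y M a<b a∉ k≡0)) ⟩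
  (z , prefixCode (pre ++ a ∷ b ∷ R) Y ++ M) ∷ [] ∎
  where
  open ≡-Reasoning
  E = prefixCode pre (a ∷ b ∷ R ++ Y)
  c = countᵇ (below a) (R ++ Y)

∂-lehmerCode-unswap : ∀ pre {a b} post → a < b → All (a ≢_) post → countᵇ (between a b) post ≡ 0 →
  ∂ (length pre) ((+ 1 , lehmerCode (pre ++ b ∷ a ∷ post)) ∷ []) ≡ (+ 1 , lehmerCode (pre ++ a ∷ b ∷ post)) ∷ []
∂-lehmerCode-unswap pre {a} {b} post a<b a∉ k≡0 = begin
  ∂ (length pre) ((+ 1 , lehmerCode (pre ++ b ∷ a ∷ post)) ∷ [])
    ≡⟨ ∂-singleton (length pre) (+ 1 , lehmerCode (pre ++ b ∷ a ∷ post)) ⟩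
  ∂term (length pre) (+ 1 , lehmerCode (pre ++ b ∷ a ∷ post))
    ≡⟨ cong (λ e → ∂term (length pre) (+ 1 , e)) (lehmerCode-split pre b a post) ⟩
  ∂term (length pre) (+ 1 , prefixCode (pre ++ b ∷ a ∷ []) post ++ lehmerCode post)
    ≡⟨ ∂term-prefixCode-unswap pre [] post (lehmerCode post) (+ 1) a<b a∉ k≡0 ⟩
  (+ 1 , prefixCode (pre ++ a ∷ b ∷ []) post ++ lehmerCode post) ∷ []
    ≡⟨ cong (λ e → (+ 1 , e) ∷ []) (sym (lehmerCode-split pre a b post)) ⟩
  (+ 1 , lehmerCode (pre ++ a ∷ b ∷ post)) ∷ [] ∎
  where open ≡-Reasoning

-- When u < v and exactly one entry of Q lies between them, the second monomial is
-- x^(lehmerCode (P ++ u ∷ v ∷ Q)); the first exchanges its exponents at the positions of u and v.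
monomials132 : List ℕ → ℕ → ℕ → List ℕ → Poly
monomials132 P u v Q =
  (+ 1 , prefixCode P (u ∷ v ∷ Q) ++ suc c ∷ c ∷ lehmerCode Q) ∷
  (+ 1 , prefixCode P (u ∷ v ∷ Q) ++ c ∷ suc c ∷ lehmerCode Q) ∷ []
  where c = countᵇ (below u) Q

∂-lehmerCode-132 : ∀ pre {a b} post → a < b → All (a ≢_) post → countᵇ (between a b) post ≡ 1 →
  ∂ (length pre) ((+ 1 , lehmerCode (pre ++ b ∷ a ∷ post)) ∷ []) ≡ monomials132 pre a b post
∂-lehmerCode-132 pre {a} {b} post a<b a∉ k≡1 = begin
  ∂ (length pre) ((+ 1 , lehmerCode (pre ++ b ∷ a ∷ post)) ∷ [])
    ≡⟨ ∂-singleton (length pre) (+ 1 , lehmerCode (pre ++ b ∷ a ∷ post)) ⟩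
  ∂term (length pre) (+ 1 , lehmerCode (pre ++ b ∷ a ∷ post))
    ≡⟨ cong (λ e → ∂term (length pre) (+ 1 , e)) (lehmerCode-split pre b a post) ⟩
  ∂term (length pre) (+ 1 , prefixCode (pre ++ b ∷ a ∷ []) post ++ lehmerCode post)
    ≡⟨ cong (λ e → ∂term (length pre) (+ 1 , e)) (prefixCode-descent pre [] post (lehmerCode post) a<b a∉ k≡1) ⟩
  ∂term (length pre) (+ 1 , prefixCode pre (a ∷ b ∷ post) ++ suc (suc c) ∷ c ∷ lehmerCode post)
    ≡⟨ ∂term-split (prefixCode pre (a ∷ b ∷ post)) c (lehmerCode post) (+ 1) (length-prefixCode pre _) ⟩
  monomials132 pre a b post ∎
  where
  open ≡-Reasoning
  c = countᵇ (below a) post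

∂-monomials132-unswap : ∀ pre {a b} R {u v} Q → a < b → All (a ≢_) (R ++ u ∷ v ∷ Q) →
  countᵇ (between a b) (R ++ u ∷ v ∷ Q) ≡ 0 →
  ∂ (length pre) (monomials132 (pre ++ b ∷ a ∷ R) u v Q) ≡ monomials132 (pre ++ a ∷ b ∷ R) u v Q
∂-monomials132-unswap pre R {u} {v} Q a<b a∉ k≡0 = cong₂ (λ s t → s ++ t ++ [])
  (∂term-prefixCode-unswap pre R (u ∷ v ∷ Q) (suc c ∷ c ∷ lehmerCode Q) (+ 1) a<b a∉ k≡0)
  (∂term-prefixCode-unswap pre R (u ∷ v ∷ Q) (c ∷ suc c ∷ lehmerCode Q) (+ 1) a<b a∉ k≡0)
  where c = countᵇ (below u) Q

data FirstAscent (w : List ℕ) : Set where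
  none  : NoAscent w → firstAscent w ≡ nothing → FirstAscent w
  found : ∀ pre {a b} post → w ≡ pre ++ a ∷ b ∷ post → a < b → NoAscent (pre ++ a ∷ []) →
          firstAscent w ≡ just (length pre) → FirstAscent w

firstAscent-view : ∀ w → FirstAscent w
firstAscent-view w with firstAscent w in eq
... | nothing = none (firstAscent-nothing w eq) eq
... | just i with firstAscent-just w i eq
...   | ascentAt pre a b post w≡ refl a<b l = found pre post w≡ a<b l eq

schubFuel-none : ∀ f n w → firstAscent w ≡ nothing → schubFuel f n w ≡ (+ 1 , topMonomial n) ∷ []
schubFuel-none f n w eq rewrite eq = refl

schubFuel-found : ∀ f n pre (a b : ℕ) post → firstAscent (pre ++ a ∷ b ∷ post) ≡ just (length pre) →
  schubFuel (suc f) n (pre ++ a ∷ b ∷ post) ≡ ∂ (length pre) (schubFuel f n (pre ++ b ∷ a ∷ post))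
schubFuel-found f n pre a b post eq rewrite eq | swapAt-length pre a b post = refl

schubFuel-dominant : ∀ f n w → Unique w → count132ʳ w ≡ 0 → nonInversions w ≤ f → length w ≡ n →
  schubFuel f n w ≡ (+ 1 , lehmerCode w) ∷ []
schubFuel-dominant f n w uniq c d l with firstAscent-view w
... | none na eq = begin
  schubFuel f n w                   ≡⟨ schubFuel-none f n w eq ⟩
  (+ 1 , topMonomial n) ∷ []        ≡⟨ cong (λ e → (+ 1 , e) ∷ []) (topMonomial≡staircase n) ⟩
  (+ 1 , staircase n) ∷ []          ≡⟨ cong (λ e → (+ 1 , staircase e) ∷ []) (sym l) ⟩
  (+ 1 , staircase (length w)) ∷ [] ≡⟨ cong (λ e → (+ 1 , e) ∷ []) (sym (lehmerCode-noAscent w na uniq)) ⟩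
  (+ 1 , lehmerCode w) ∷ []         ∎
  where open ≡-Reasoning
... | found pre {a} {b} post refl a<b na eq with f
...   | zero   = ⊥-elim (n≮0 (subst (_≤ 0) (nonInversions-swap pre post a<b) d))
...   | suc f′ = begin
  schubFuel (suc f′) n (pre ++ a ∷ b ∷ post)
    ≡⟨ schubFuel-found f′ n pre a b post eq ⟩
  ∂ (length pre) (schubFuel f′ n (pre ++ b ∷ a ∷ post))
    ≡⟨ cong (∂ (length pre)) (schubFuel-dominant f′ n _ uniq′ c′ d′ l′) ⟩
  ∂ (length pre) ((+ 1 , lehmerCode (pre ++ b ∷ a ∷ post)) ∷ [])
    ≡⟨ ∂-lehmerCode-unswap pre post a<b a∉ k≡0 ⟩
  (+ 1 , lehmerCode (pre ++ a ∷ b ∷ post)) ∷ [] ∎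
  where
  open ≡-Reasoning
  split = trans (sym (count132ʳ-swap pre post a<b (NoAscent⇒All≥last pre na))) c
  k≡0 = m+n≡0⇒m≡0 (countᵇ (between a b) post) split
  c′  = m+n≡0⇒n≡0 (countᵇ (between a b) post) split
  a∉  = All.tail (Unique⇒∉suffix pre (b ∷ post) uniq)
  uniq′ = Unique-swap pre post uniq
  d′  = ≤-pred (subst (_≤ suc f′) (nonInversions-swap pre post a<b) d)
  l′  = trans (↭-length (↭-sym (adjacentSwap↭ pre a b post))) l

-- Permutations with exactly one occurrence of 132

record TwoMonomials132 (w : List ℕ) (f : Poly) : Set where
  constructor twoMonomials132
  field
    P          : List ℕ
    u v        : ℕ
    Q          : List ℕ
    w≡         : w ≡ P ++ u ∷ v ∷ Q
    u<v        : u < v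
    oneBetween : countᵇ (between u v) Q ≡ 1
    f≡         : f ≡ monomials132 P u v Q

++-≡-++ : ∀ (A B C D : List ℕ) → A ++ B ≡ C ++ D →
  (Σ[ R ∈ List ℕ ] C ≡ A ++ R × B ≡ R ++ D) ⊎ (Σ[ r ∈ ℕ ] Σ[ R ∈ List ℕ ] A ≡ C ++ r ∷ R × D ≡ r ∷ R ++ B)
++-≡-++ []      B C       D eq = inj₁ (C , refl , eq)
++-≡-++ (x ∷ A) B []      D eq = inj₂ (x , A , refl , sym eq)
++-≡-++ (x ∷ A) B (y ∷ C) D eq with ∷-injective eq
... | refl , eq′ with ++-≡-++ A B C D eq′
...   | inj₁ (R , C≡ , B≡)     = inj₁ (R , cong (x ∷_) C≡ , B≡)
...   | inj₂ (r , R , A≡ , D≡) = inj₂ (r , R , cong (x ∷_) A≡ , D≡)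

countᵇ≡0⇒false : ∀ p {xs z} → countᵇ p xs ≡ 0 → z ∈ xs → p z ≡ true → ⊥
countᵇ≡0⇒false p eq z∈xs pz = n≮0 (subst (1 ≤_) eq (countᵇ-pos p z∈xs pz))

m+n≡1⇒ : ∀ m n → m + n ≡ 1 → (m ≡ 0 × n ≡ 1) ⊎ (m ≡ 1 × n ≡ 0)
m+n≡1⇒ zero          n    eq   = inj₁ (refl , eq)
m+n≡1⇒ (suc zero)    zero refl = inj₂ (refl , refl)

-- Let z be the entry of Q between a and v: if b < z then (b, v, z) is a second occurrence of 132, and if z < b
-- then z is an entry of v ∷ Q between a and b.
unique132-not-from-a : ∀ pre {a b v} Q → Unique (pre ++ b ∷ a ∷ v ∷ Q) → countᵇ (between a b) (v ∷ Q) ≡ 0 →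
  count132ʳ (pre ++ b ∷ a ∷ v ∷ Q) ≡ 1 → countᵇ (between a v) Q ≡ 1 → ⊥
unique132-not-from-a pre {a} {b} {v} Q uniq k≡0 one oneBetween
  with countᵇ-witness (between a v) Q oneBetween
... | z , z∈Q , a<z<v with between-true⁻¹ {a} {v} {z} a<z<v | <-cmp b z
...   | a<z , z<v | tri< b<z _ _ = <⇒≱ (s≤s (s≤s z≤n)) (≤-trans two (subst (count132ʳ (b ∷ a ∷ v ∷ Q) ≤_) one
                                          (count132ʳ-++-≥ pre (b ∷ a ∷ v ∷ Q))))
  where
  two : 2 ≤ count132ʳ (b ∷ a ∷ v ∷ Q)
  two = +-mono-≤
    (≤-trans (countᵇ-pos (between b v) z∈Q (between-true b<z z<v))
             (≤-trans (m≤m+n _ (count132From b Q)) (m≤n+m _ (countᵇ (between b a) (v ∷ Q)))))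
    (≤-trans (≤-reflexive (sym oneBetween))
             (≤-trans (m≤m+n _ (count132From a Q)) (m≤m+n _ (count132ʳ (v ∷ Q)))))
...   | _ | tri≈ _ b≡z _ = lookup (Unique⇒∉suffix pre (a ∷ v ∷ Q) uniq) (there (there z∈Q)) b≡z
...   | a<z , _ | tri> _ _ z<b = countᵇ≡0⇒false (between a b) k≡0 (there z∈Q) (between-true {a} {b} a<z z<b)

-- An entry z of a ∷ post between u and b is neither a ≤ u nor, exceeding u ≥ a, an entry of post.
unique132-not-into-b : ∀ P {u a b} post → NoAscent (P ++ u ∷ a ∷ []) → countᵇ (between a b) post ≡ 0 →
  countᵇ (between u b) (a ∷ post) ≡ 1 → ⊥
unique132-not-into-b P {u} {a} {b} post na k≡0 oneBetween
  with countᵇ-witness (between u b) (a ∷ post) oneBetween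
... | z , z∈ , u<z<b with between-true⁻¹ {u} {b} {z} u<z<b | z∈
...   | u<z , _   | here refl = <⇒≱ u<z (NoAscent-adjacent P na)
...   | u<z , z<b | there z∈post =
  countᵇ≡0⇒false (between a b) k≡0 z∈post (between-true {a} {b} (≤-<-trans (NoAscent-adjacent P na) u<z) z<b)

locate132 : ∀ pre {a b} post P {u v} Q → pre ++ b ∷ a ∷ post ≡ P ++ u ∷ v ∷ Q →
  a < b → NoAscent (pre ++ a ∷ []) → Unique (pre ++ b ∷ a ∷ post) → countᵇ (between a b) post ≡ 0 →
  count132ʳ (pre ++ b ∷ a ∷ post) ≡ 1 → u < v → countᵇ (between u v) Q ≡ 1 →
  Σ[ R ∈ List ℕ ] P ≡ pre ++ b ∷ a ∷ R × post ≡ R ++ u ∷ v ∷ Q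
locate132 pre {a} {b} post P Q eq a<b na uniq k≡0 one u<v oneBetween
  with ++-≡-++ pre (_ ∷ _ ∷ post) P (_ ∷ _ ∷ Q) eq
... | inj₁ ([]          , _  , refl) = ⊥-elim (<-asym a<b u<v)
... | inj₁ (_ ∷ []      , _  , refl) = ⊥-elim (unique132-not-from-a pre Q uniq k≡0 one oneBetween)
... | inj₁ (_ ∷ _ ∷ R   , P≡ , refl) = R , P≡ , refl
... | inj₂ (_ , []      , refl , refl) =
  ⊥-elim (unique132-not-into-b P {b = b} post (subst NoAscent (++-assoc P _ _) na) k≡0 oneBetween)
... | inj₂ (_ , _ ∷ R   , refl , refl) =
  ⊥-elim (<⇒≱ u<v (NoAscent-adjacent P (subst NoAscent (++-assoc P _ _) na)))

TwoMonomials132-unswap : ∀ pre {a b} post {f} → a < b → NoAscent (pre ++ a ∷ []) → All (a ≢_) post →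
  Unique (pre ++ b ∷ a ∷ post) → countᵇ (between a b) post ≡ 0 → count132ʳ (pre ++ b ∷ a ∷ post) ≡ 1 →
  TwoMonomials132 (pre ++ b ∷ a ∷ post) f → TwoMonomials132 (pre ++ a ∷ b ∷ post) (∂ (length pre) f)
TwoMonomials132-unswap pre {a} {b} post a<b na a∉ uniq k≡0 one (twoMonomials132 P u v Q w≡ u<v oneBetween refl)
  with locate132 pre post P Q w≡ a<b na uniq k≡0 one u<v oneBetween
... | R , refl , refl =
  twoMonomials132 (pre ++ a ∷ b ∷ R) u v Q (sym (++-assoc pre (a ∷ b ∷ R) (u ∷ v ∷ Q))) u<v oneBetween
    (∂-monomials132-unswap pre R Q a<b a∉ k≡0)

schubFuel-one132 : ∀ f n w → Unique w → count132ʳ w ≡ 1 → nonInversions w ≤ f → length w ≡ n →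
  TwoMonomials132 w (schubFuel f n w)
schubFuel-one132 f n w uniq c d l with firstAscent-view w
... | none na _ = ⊥-elim (0≢1+n (trans (sym (count132ʳ-noAscent w na)) c))
... | found pre {a} {b} post refl a<b na eq with f
...   | zero   = ⊥-elim (n≮0 (subst (_≤ 0) (nonInversions-swap pre post a<b) d))
...   | suc f′ = subst (TwoMonomials132 (pre ++ a ∷ b ∷ post)) (sym (schubFuel-found f′ n pre a b post eq))
                       (step (m+n≡1⇒ k (count132ʳ w′) split))
  where
  w′    = pre ++ b ∷ a ∷ post
  split = trans (sym (count132ʳ-swap pre post a<b (NoAscent⇒All≥last pre na))) c
  a∉    = All.tail (Unique⇒∉suffix pre (b ∷ post) uniq)
  uniq′ = Unique-swap pre post uniq
  d′    = ≤-pred (subst (_≤ suc f′) (nonInversions-swap pre post a<b) d)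
  l′    = trans (↭-length (↭-sym (adjacentSwap↭ pre a b post))) l
  k = countᵇ (between a b) post
  step : (k ≡ 0 × count132ʳ w′ ≡ 1) ⊎ (k ≡ 1 × count132ʳ w′ ≡ 0) →
         TwoMonomials132 (pre ++ a ∷ b ∷ post) (∂ (length pre) (schubFuel f′ n w′))
  step (inj₁ (k≡0 , c′≡1)) =
    TwoMonomials132-unswap pre post a<b na a∉ uniq′ k≡0 c′≡1 (schubFuel-one132 f′ n w′ uniq′ c′≡1 d′ l′)
  step (inj₂ (k≡1 , c′≡0)) = twoMonomials132 pre a b post refl a<b k≡1 (begin
    ∂ (length pre) (schubFuel f′ n w′)
      ≡⟨ cong (∂ (length pre)) (schubFuel-dominant f′ n w′ uniq′ c′≡0 d′ l′) ⟩
    ∂ (length pre) ((+ 1 , lehmerCode w′) ∷ [])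
      ≡⟨ ∂-lehmerCode-132 pre post a<b a∉ k≡1 ⟩
    monomials132 pre a b post ∎)
    where open ≡-Reasoning

mainTheorem3 : (n : ℕ) (w : List ℕ) → IsPerm n w → count132 w ≡ 1 → ν w ≡ + 2
mainTheorem3 n w w↭ one = cong evalOnes (TwoMonomials132.f≡ shape)
  where
  shape : TwoMonomials132 w (schubert w)
  shape = schubFuel-one132 (length w * length w) (length w) w (IsPerm⇒Unique n w w↭)
            (trans (sym (count132≡count132ʳ w)) one) (nonInversions≤length² w) refl
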